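{- For every signed permutation $\pi$, $\Gamma(\pi)=F_{\mathrm{wcomp}(\pi)}$.
   Context: $\mathfrak{B}_n$ is the set of permutations $\pi$ of $\{ -n,\dots,n\}$ with $\pi(-i)=-\pi(i)$, written as words $\pi_1\cdots\pi_n$. Signed $P$-partitions: for $\pi\in\mathfrak{B}_n$, $A(\pi)$ is the set of functions $f:\{\pi_1,\dots,\pi_n\}\to\mathbb{P}$ (positive integers) with $f(\pi_1)\le f(\pi_2)\le\cdots\le f(\pi_n)$ and $f(\pi_i)<f(\pi_{i+1})$ whenever $\pi_i>\max(0,\pi_{i+1})$. $\widetilde{\mathbb{N}}=\mathbb{N}\cup\{\varepsilon\}$ with $0+\varepsilon=\varepsilon+\varepsilon=\varepsilon$ and $n+\varepsilon=n$ for $n\ge1$; monomials in commuting variables $x_1,x_2,\dots$ have exponents in $\widetilde{\mathbb{N}}$ with $x^ax^b=x^{a+b}$, $x^0=1$. The weight of $f$ is $w(f)=\prod_{i=1}^n x_{f(\pi_i)}^{\delta(\pi_i)}$, where $\delta(a)=1$ if $a>0$ and $\delta(a)=\varepsilon$ if $a<0$; $\Gamma(\pi)=\sum_{f\in A(\pi)}w(f)$. A regularized composition is a finite sequence of elements of $\mathbb{P}\cup\{\varepsilon\}$; write it as $\alpha=(\varepsilon^{i_1},s_1,\dots,\varepsilon^{i_k},s_k,\varepsilon^{i_{k+1}})$ with $s_q\in\mathbb{P}$ ($\varepsilon^i$ = $i$ consecutive $\varepsilon$'s); let $n=\sum i_p+\sum s_q$, $D(\alpha)=\{\sum_{j\le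 q}(i_j+s_j):q\in[k]\}$, $(e_1,\dots,e_n)=(\varepsilon^{i_1},1^{s_1},\dots,\varepsilon^{i_k},1^{s_k},\varepsilon^{i_{k+1}})$, and $F_\alpha=\sum x_{j_1}^{e_1}\cdots x_{j_n}^{e_n}$ over $j_1\le\cdots\le j_n$ with $j_p<j_{p+1}$ whenever $p\in D(\alpha)$, $p<n$ ($F_\emptyset=1$). For a word $w=w_1\cdots w_r$ of distinct positive integers, $\mathrm{comp}(w)$ is the composition of $r$ with set of partial sums $\{i\in[r-1]:w_i>w_{i+1}\}\cup\{r\}$. For $\pi\in\mathfrak{B}_n$ write $\pi=(N_1,B_1,\dots,N_k,B_k,N_{k+1})$ with $B_q$ the maximal nonempty runs of consecutive positive entries and $N_p$ consisting of $i_p\ge0$ negative entries; $\mathrm{wcomp}(\pi)=(\varepsilon^{i_1},\mathrm{comp}(B_1),\dots,\varepsilon^{i_k},\mathrm{comp}(B_k),\varepsilon^{i_{k+1}})$. -}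

module Defs where

open import Data.Bool using (Bool; true; false; if_then_else_; not; _∧_)
open import Data.Nat as ℕ using (ℕ; zero; suc; _≡ᵇ_; _≤ᵇ_; _<ᵇ_)
open import Data.Integer as ℤ using (ℤ; +_; -[1+_]; _⊔_; 0ℤ)
open import Data.Fin using (Fin; toℕ)
open import Data.Fin.Permutation using (Permutation′; _⟨$⟩ʳ_)
open import Data.List using (List; []; _∷_; _++_; [_]; map; concatMap; applyUpTo;
  filterᵇ; reverse; replicate; allFin; zip; foldr; length)
open import Data.Product using (_×_; _,_)

data Ñ : Set where
  nat : ℕ → Ñ
  ε   : Ñ

_+Ñ_ : Ñ → Ñ → Ñ
nat a       +Ñ nat b = nat (a ℕ.+ b)
nat zero    +Ñ ε     = ε
nat (suc a) +Ñ ε     = nat (suc a)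
ε           +Ñ nat zero    = ε
ε           +Ñ nat (suc b) = nat (suc b)
ε           +Ñ ε     = ε

sumÑ : List Ñ → Ñ
sumÑ = foldr _+Ñ_ (nat 0)

-- Monomials in x_1,...,x_N : exponent list (e_1,...,e_N), e_k ∈ Ñ
-- (x_k for k > N do not occur).  A weighted "letter" is a pair
-- (variable index k ≥ 1, exponent).

monomial : (N : ℕ) → List (ℕ × Ñ) → List Ñ
monomial N ls =
  applyUpTo (λ k → sumÑ (map (λ { (j , e) → if j ≡ᵇ suc k then e else nat 0 }) ls)) N

words : (n N : ℕ) → List (List ℕ)
words zero    N = [ [] ]
words (suc n) N = concatMap (λ w → map (_∷ w) (applyUpTo suc N)) (words n N)

-- Signed permutations  𝔅_n : π(i) = ± (σ(i)+1), sign given by `neg`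

record SignedPerm (n : ℕ) : Set where
  field
    perm : Permutation′ n
    neg  : Fin n → Bool

word : ∀ {n} → SignedPerm n → List ℤ
word {n} π = map entry (allFin n)
  where
  open SignedPerm π
  entry : Fin n → ℤ
  entry i with neg i
  ... | true  = -[1+ toℕ (perm ⟨$⟩ʳ i) ]
  ... | false = + suc (toℕ (perm ⟨$⟩ʳ i))

δ : ℤ → Ñ
δ (+ _)    = nat 1
δ -[1+ _ ] = ε

strictAt : ℤ → ℤ → Bool
strictAt a b = not (a ℤ.≤ᵇ (0ℤ ⊔ b))

-- condition for f ∈ A(π), given the list of pairs (π_i , f(π_i));
-- positivity of the values is built into `words`.
isPPart : List (ℤ × ℕ) → Bool
isPPart ((a , x) ∷ (b , y) ∷ rest) =
  (if strictAt a b then x <ᵇ y else x ≤ᵇ y) ∧ isPPart ((b , y) ∷ rest)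
isPPart _ = true

-- Γ(π) truncated to variables x_1..x_N: the list (multiset) of the
-- monomials w(f) for f ∈ A(π) with values in {1,...,N}.
ΓN : ∀ {n} → SignedPerm n → (N : ℕ) → List (List Ñ)
ΓN {n} π N =
  map (λ f → monomial N (zip f (map δ (word π))))
      (filterᵇ (λ f → isPPart (zip (word π) f)) (words n N))

-- Regularized compositions: entries in ℙ ∪ {ε}.
-- `pos s` represents the positive integer s+1.

data Part : Set where
  εp  : Part
  pos : ℕ → Part

RegComp : Set
RegComp = List Part

-- expansion of α into (e_1,…,e_n) together with the flag "p ∈ D(α)"
-- (p ∈ D(α) iff p is the last position of a block of a positive part)
expand : RegComp → List (Ñ × Bool)
expand [] = []
expand (εp ∷ α)    = (ε , false) ∷ expand α
expand (pos s ∷ α) = replicate s (nat 1 , false) ++ (nat 1 , true) ∷ expand α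

isFseq : List ((Ñ × Bool) × ℕ) → Bool
isFseq (((_ , d) , x) ∷ (e , y) ∷ rest) =
  (if d then x <ᵇ y else x ≤ᵇ y) ∧ isFseq ((e , y) ∷ rest)
isFseq _ = true

-- F_α truncated to variables x_1..x_N, as a multiset of monomials
FN : RegComp → (N : ℕ) → List (List Ñ)
FN α N =
  map (λ j → monomial N (zip j (map (λ { (e , _) → e }) (expand α))))
      (filterᵇ (λ j → isFseq (zip (expand α) j)) (words (length (expand α)) N))

-- comp(w) for a word of distinct positive integers: parts are the gaps
-- between consecutive elements of {i : w_i > w_{i+1}} ∪ {r}.
-- compGo c l ws : current part has size c+1 and last letter l.
compGo : ℕ → ℕ → List ℕ → RegComp
compGo c l []       = [ pos c ]
compGo c l (b ∷ bs) = if b <ᵇ l then pos c ∷ compGo 0 b bs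
                                else compGo (suc c) b bs

comp : List ℕ → RegComp
comp []       = []
comp (b ∷ bs) = compGo 0 b bs

-- wcomp: acc holds the current run of positive entries (reversed)
wcompGo : List ℕ → List ℤ → RegComp
wcompGo acc []               = comp (reverse acc)
wcompGo acc (-[1+ _ ] ∷ xs)  = comp (reverse acc) ++ εp ∷ wcompGo [] xs
wcompGo acc ((+ m) ∷ xs)     = wcompGo (m ∷ acc) xs

wcomp : ∀ {n} → SignedPerm n → RegComp
wcomp π = wcompGo [] (word π)

-- Both Γ(π) and F_α enumerate weakly increasing sequences subject to strict
-- inequalities at marked positions. For α = wcomp π the exponents of F_α are δ(πᵢ)
-- and position i is marked exactly when πᵢ > max(0, πᵢ₊₁) (with πₙ₊₁ = 0): inside a
-- positive run the marks are the descents, a positive run always ends in D(α)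
-- because it is followed by a negative entry or by the end of π, and a negative
-- entry is never marked. So the two sums run over the same sequences with the same
-- monomials, and the truncated lists agree on the nose.
module Submission where

open import Defs
open import Data.Nat using (ℕ)
open import Data.List.Relation.Binary.Permutation.Propositional using (_↭_)

open import Data.Bool using (Bool; true; false; not; _∧_; T)
open import Data.Bool.Properties using (T?)
open import Data.Nat as ℕ using (zero; suc; _<ᵇ_; _≤ᵇ_)
open import Data.Integer as ℤ using (ℤ; +_; -[1+_]; 0ℤ)
open import Data.List
  using (List; []; _∷_; [_]; _++_; map; head; reverse; replicate; zip; length; filterᵇ; allFin)
open import Data.List.Properties
  using (++-assoc; ++-identityʳ; map-++; map-cong; filter-≐; length-map; length-tabulate;
         unfold-reverse)
open import Data.List.Relation.Unary.All using (All; []; _∷_; tabulate)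
open import Data.List.Relation.Unary.All.Properties using (++⁺)
open import Data.List.Membership.Propositional using (_∈_)
open import Data.List.Membership.Propositional.Properties using (∈-map⁻)
open import Data.List.Relation.Binary.Permutation.Propositional using (↭-reflexive)
open import Data.Maybe using (fromMaybe)
open import Data.Product using (_×_; _,_; proj₁)
open import Function using (_∘_)
open import Relation.Binary.PropositionalEquality
  using (_≡_; _≗_; refl; sym; trans; cong; cong₂; subst; module ≡-Reasoning)
open ≡-Reasoning

not-≤ᵇ : ∀ m n → not (m ≤ᵇ n) ≡ (n <ᵇ m)
not-≤ᵇ zero          zero    = refl
not-≤ᵇ zero          (suc n) = refl
not-≤ᵇ (suc m)       zero    = refl
not-≤ᵇ (suc zero)    (suc n) = refl
not-≤ᵇ (suc (suc m)) (suc n) = not-≤ᵇ (suc m) n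

replicate-suc-++ : ∀ {A : Set} n (x : A) ys → replicate (suc n) x ++ ys ≡ replicate n x ++ x ∷ ys
replicate-suc-++ zero    x ys = refl
replicate-suc-++ (suc n) x ys = cong (x ∷_) (replicate-suc-++ n x ys)

map-reverse-∷-++ : ∀ {A B : Set} (f : A → B) x xs ys →
                   map f (reverse (x ∷ xs)) ++ ys ≡ map f (reverse xs) ++ f x ∷ ys
map-reverse-∷-++ f x xs ys = begin
  map f (reverse (x ∷ xs)) ++ ys        ≡⟨ cong (λ zs → map f zs ++ ys) (unfold-reverse x xs) ⟩
  map f (reverse xs ++ [ x ]) ++ ys     ≡⟨ cong (_++ ys) (map-++ f (reverse xs) [ x ]) ⟩
  (map f (reverse xs) ++ [ f x ]) ++ ys ≡⟨ ++-assoc (map f (reverse xs)) [ f x ] ys ⟩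
  map f (reverse xs) ++ f x ∷ ys        ∎

filterᵇ-cong : ∀ {A : Set} {p q : A → Bool} → p ≗ q → filterᵇ p ≗ filterᵇ q
filterᵇ-cong {p = p} {q} p≗q =
  filter-≐ (T? ∘ p) (T? ∘ q) ((λ {x} → subst T (p≗q x)) , (λ {x} → subst T (sym (p≗q x))))

-- The analogue of `expand` for a word π₁ ⋯ πₙ: position i carries δ(πᵢ) and the
-- strictness flag πᵢ > max(0, πᵢ₊₁), with the convention πₙ₊₁ = 0.
annotate : List ℤ → List (Ñ × Bool)
annotate []      = []
annotate (a ∷ w) = (δ a , strictAt a (fromMaybe 0ℤ (head w))) ∷ annotate w

map-proj₁-annotate : ∀ w → map proj₁ (annotate w) ≡ map δ w
map-proj₁-annotate []      = refl
map-proj₁-annotate (a ∷ w) = cong (δ a ∷_) (map-proj₁-annotate w)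

length-annotate : ∀ w → length (annotate w) ≡ length w
length-annotate []      = refl
length-annotate (a ∷ w) = cong suc (length-annotate w)

isPPart≡isFseq-annotate : ∀ w f → isPPart (zip w f) ≡ isFseq (zip (annotate w) f)
isPPart≡isFseq-annotate []          f           = refl
isPPart≡isFseq-annotate (a ∷ [])    []          = refl
isPPart≡isFseq-annotate (a ∷ [])    (x ∷ f)     = refl
isPPart≡isFseq-annotate (a ∷ b ∷ w) []          = refl
isPPart≡isFseq-annotate (a ∷ b ∷ w) (x ∷ [])    = refl
isPPart≡isFseq-annotate (a ∷ b ∷ w) (x ∷ y ∷ f) =
  cong (_ ∧_) (isPPart≡isFseq-annotate (b ∷ w) (y ∷ f))

annotate-negative : ∀ k w → annotate (-[1+ k ] ∷ w) ≡ (ε , false) ∷ annotate w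
annotate-negative k []             = refl
annotate-negative k (+ m ∷ w)      = refl
annotate-negative k (-[1+ j ] ∷ w) = refl

-- strictAt a b sees b only through max(0, b), so a negative successor acts like πₙ₊₁ = 0.
annotate-++-negative : ∀ v k w →
                       annotate (v ++ -[1+ k ] ∷ w) ≡ annotate v ++ annotate (-[1+ k ] ∷ w)
annotate-++-negative []          k w = refl
annotate-++-negative (a ∷ [])    k w = refl
annotate-++-negative (a ∷ b ∷ v) k w =
  cong ((δ a , strictAt a b) ∷_) (annotate-++-negative (b ∷ v) k w)

expand-++ : ∀ α β → expand (α ++ β) ≡ expand α ++ expand β
expand-++ []          β = refl
expand-++ (εp ∷ α)    β = cong (_ ∷_) (expand-++ α β)
expand-++ (pos s ∷ α) β = begin
  replicate s (nat 1 , false) ++ (nat 1 , true) ∷ expand (α ++ β)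
    ≡⟨ cong (λ e → replicate s (nat 1 , false) ++ (nat 1 , true) ∷ e) (expand-++ α β) ⟩
  replicate s (nat 1 , false) ++ (nat 1 , true) ∷ expand α ++ expand β
    ≡⟨ ++-assoc (replicate s (nat 1 , false)) ((nat 1 , true) ∷ expand α) (expand β) ⟨
  (replicate s (nat 1 , false) ++ (nat 1 , true) ∷ expand α) ++ expand β ∎

expand-compGo : ∀ c l bs → All ℕ.NonZero (l ∷ bs) →
                expand (compGo c l bs) ≡ replicate c (nat 1 , false) ++ annotate (map +_ (l ∷ bs))
expand-compGo c (suc l) [] _ = refl   -- l = 0 is ruled out by NonZero
expand-compGo c l (b ∷ bs) (_ ∷ nz) rewrite not-≤ᵇ l b with b <ᵇ l
... | true  = cong (λ e → replicate c (nat 1 , false) ++ (nat 1 , true) ∷ e)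
                   (expand-compGo 0 b bs nz)
... | false = trans (expand-compGo (suc c) b bs nz)
                    (replicate-suc-++ c (nat 1 , false) (annotate (map +_ (b ∷ bs))))

expand-comp : ∀ bs → All ℕ.NonZero bs → expand (comp bs) ≡ annotate (map +_ bs)
expand-comp []       _  = refl
expand-comp (l ∷ bs) nz = expand-compGo 0 l bs nz

expand-wcompGo : ∀ acc w → All ℕ.NonZero (reverse acc) → All ℤ.NonZero w →
                 expand (wcompGo acc w) ≡ annotate (map +_ (reverse acc) ++ w)
expand-wcompGo acc [] run _ = begin
  expand (comp (reverse acc))           ≡⟨ expand-comp (reverse acc) run ⟩
  annotate (map +_ (reverse acc))       ≡⟨ cong annotate (++-identityʳ _) ⟨
  annotate (map +_ (reverse acc) ++ []) ∎
expand-wcompGo acc (-[1+ k ] ∷ w) run (_ ∷ nz) = begin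
  expand (comp (reverse acc) ++ εp ∷ wcompGo [] w)
    ≡⟨ expand-++ (comp (reverse acc)) (εp ∷ wcompGo [] w) ⟩
  expand (comp (reverse acc)) ++ (ε , false) ∷ expand (wcompGo [] w)
    ≡⟨ cong₂ (λ u v → u ++ (ε , false) ∷ v)
             (expand-comp (reverse acc) run) (expand-wcompGo [] w [] nz) ⟩
  annotate (map +_ (reverse acc)) ++ (ε , false) ∷ annotate w
    ≡⟨ cong (annotate (map +_ (reverse acc)) ++_) (annotate-negative k w) ⟨
  annotate (map +_ (reverse acc)) ++ annotate (-[1+ k ] ∷ w)
    ≡⟨ annotate-++-negative (map +_ (reverse acc)) k w ⟨
  annotate (map +_ (reverse acc) ++ -[1+ k ] ∷ w) ∎
expand-wcompGo acc (+ m ∷ w) run (m≢0 ∷ nz) = begin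
  expand (wcompGo (m ∷ acc) w)                 ≡⟨ expand-wcompGo (m ∷ acc) w run′ nz ⟩
  annotate (map +_ (reverse (m ∷ acc)) ++ w)   ≡⟨ cong annotate (map-reverse-∷-++ +_ m acc w) ⟩
  annotate (map +_ (reverse acc) ++ + m ∷ w)   ∎
  where
  run′ : All ℕ.NonZero (reverse (m ∷ acc))
  run′ = subst (All ℕ.NonZero) (sym (unfold-reverse m acc)) (++⁺ run (m≢0 ∷ []))

word-nonZero : ∀ {n} (π : SignedPerm n) → All ℤ.NonZero (word π)
word-nonZero π = tabulate entry-nonZero
  where
  entry-nonZero : ∀ {x} → x ∈ word π → ℤ.NonZero x
  entry-nonZero x∈π with ∈-map⁻ _ x∈π
  ... | i , _ , refl with SignedPerm.neg π i
  ...   | true  = _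
  ...   | false = _

expand-wcomp : ∀ {n} (π : SignedPerm n) → expand (wcomp π) ≡ annotate (word π)
expand-wcomp π = expand-wcompGo [] (word π) [] (word-nonZero π)

length-word : ∀ {n} (π : SignedPerm n) → length (word π) ≡ n
length-word {n} π = trans (length-map _ (allFin n)) (length-tabulate (λ i → i))

Γ-word : List ℤ → (n N : ℕ) → List (List Ñ)
Γ-word w n N =
  map (λ f → monomial N (zip f (map δ w))) (filterᵇ (λ f → isPPart (zip w f)) (words n N))

FN-annotate : ∀ {α w} N → expand α ≡ annotate w → FN α N ≡ Γ-word w (length w) N
FN-annotate {w = w} N e rewrite e | length-annotate w =
  trans (map-cong (λ f → cong (λ es → monomial N (zip f es)) (map-proj₁-annotate w)) _)
        (cong (map _)
              (filterᵇ-cong (λ f → sym (isPPart≡isFseq-annotate w f)) (words (length w) N)))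

theorem5p4 : (n : ℕ) (π : SignedPerm n) (N : ℕ) → ΓN π N ↭ FN (wcomp π) N
theorem5p4 n π N = ↭-reflexive (begin
  ΓN π N                                ≡⟨ cong (λ m → Γ-word (word π) m N) (length-word π) ⟨
  Γ-word (word π) (length (word π)) N   ≡⟨ FN-annotate {wcomp π} N (expand-wcomp π) ⟨
  FN (wcomp π) N                        ∎)
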